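{- Let $\mathbb{K}$ be a commutative ring, $F=\mathbb{K}\{x_1,\dots,x_m\}$, $n\ge1$. The algebra $TS^n_{\mathbb{K}}(F)$ of symmetric tensors of order $n$ is generated by the elements $e^n_i(\upsilon)$ with $1\le i\le n$ and $\upsilon$ a monomial of positive degree in $x_1,\dots,x_m$.
   Context: $TS^n_{\mathbb{K}}(F)=(F^{\otimes n})^{S_n}$. For $f\in F$, $e^n_i(f)$ is defined by $\sum_{i=0}^nt^ie^n_i(f)=(1\otimes1+t\otimes f)^{\otimes n}$ in $\mathbb{K}[t]\otimes_{\mathbb{K}}F^{\otimes n}$. Monomials are words in $x_1,\dots,x_m$. -}

module Defs where

open import Level using (_⊔_)
open import Algebra.Bundles using (CommutativeRing)
open import Data.Nat using (ℕ; zero; suc; _≤_)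
open import Data.Fin using (Fin)
import Data.Fin as Fin
open import Data.List using (List; []; _∷_; _++_; map; concatMap; length)
import Data.List.Properties as LP
open import Data.Vec using (Vec; []; _∷_; zipWith; replicate; tabulate; lookup)
import Data.Vec.Properties as VP
open import Data.Product using (_×_; _,_; Σ)
open import Data.Fin.Permutation using (Permutation′; _⟨$⟩ʳ_)
open import Relation.Nullary using (Dec; yes; no)
open import Relation.Binary.PropositionalEquality using (_≡_)

-- Words (monomials) in x_1..x_m : the K-basis of F = K{x_1..x_m}
Word : ℕ → Set
Word m = List (Fin m)

-- n-tuples of words: the K-basis  v_1 ⊗ ... ⊗ v_n  of F^{⊗n}
Tup : ℕ → ℕ → Set
Tup m n = Vec (Word m) n

tup-≟ : ∀ {m n} (s t : Tup m n) → Dec (s ≡ t)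
tup-≟ = VP.≡-dec (LP.≡-dec Fin._≟_)

permuteTup : ∀ {m n} → Permutation′ n → Tup m n → Tup m n
permuteTup σ t = tabulate (λ j → lookup t (σ ⟨$⟩ʳ j))

module _ {c ℓ} (R : CommutativeRing c ℓ) (m : ℕ) where
  open CommutativeRing R using (_≈_; _+_; _*_; 0#; 1#) renaming (Carrier to K)

  -- Elements of F = K{x_1..x_m}: finite formal K-linear combinations of words
  Free : Set c
  Free = List (K × Word m)

  -- Elements of F^{⊗n}: finite formal K-linear combinations of basis tensors
  Tensor : ℕ → Set c
  Tensor n = List (K × Tup m n)

  coeff : ∀ {n} → Tensor n → Tup m n → K
  coeff [] t = 0#
  coeff ((k , s) ∷ a) t with tup-≟ s t
  ... | yes _ = k + coeff a t
  ... | no  _ = coeff a t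

  _≈T_ : ∀ {n} → Tensor n → Tensor n → Set ℓ
  a ≈T b = ∀ t → coeff a t ≈ coeff b t

  oneT : ∀ {n} → Tensor n
  oneT {n} = (1# , replicate n []) ∷ []

  addT : ∀ {n} → Tensor n → Tensor n → Tensor n
  addT = _++_

  scaleT : ∀ {n} → K → Tensor n → Tensor n
  scaleT k = map (λ { (c , t) → (k * c , t) })

  mulT : ∀ {n} → Tensor n → Tensor n → Tensor n
  mulT a b = concatMap (λ { (c , t) → map (λ { (d , s) → (c * d , zipWith _++_ t s) }) b }) a

  IsSymmetric : ∀ {n} → Tensor n → Set ℓ
  IsSymmetric {n} a = ∀ (σ : Permutation′ n) (t : Tup m n) → coeff a (permuteTup σ t) ≈ coeff a t

  -- e^n_i(f): coefficient of t^i in (1⊗1 + t⊗f)^{⊗n}, computed by expanding the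
  -- first tensor factor: e^{n+1}_{i+1}(f) = 1 ⊗ e^n_{i+1}(f) + f ⊗ e^n_i(f)
  e : (n i : ℕ) → Free → Tensor n
  e zero zero f = (1# , []) ∷ []
  e zero (suc i) f = []
  e (suc n) zero f = map (λ { (d , t) → (d , [] ∷ t) }) (e n zero f)
  e (suc n) (suc i) f =
    map (λ { (d , t) → (d , [] ∷ t) }) (e n (suc i) f)
    ++ concatMap (λ { (c , w) → map (λ { (d , t) → (c * d , w ∷ t) }) (e n i f) }) f

  mono : Word m → Free
  mono v = (1# , v) ∷ []

  -- noncommutative K-algebra expressions in the generators e^n_i(υ), 1 ≤ i ≤ n, deg υ ≥ 1
  data GenExpr (n : ℕ) : Set c where
    gen  : (i : ℕ) → 1 ≤ i → i ≤ n → (v : Word m) → 1 ≤ length v → GenExpr n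
    scal : K → GenExpr n
    plus : GenExpr n → GenExpr n → GenExpr n
    times : GenExpr n → GenExpr n → GenExpr n

  eval : ∀ {n} → GenExpr n → Tensor n
  eval {n} (gen i _ _ v _) = e n i (mono v)
  eval (scal k) = scaleT k oneT
  eval (plus x y) = addT (eval x) (eval y)
  eval (times x y) = mulT (eval x) (eval y)

{-# OPTIONS --safe #-}

-- The degree of a tuple of words is its number of nonempty entries. If υ₁ … υᵣ are the distinct
-- nonempty entries of a tuple t, occurring k₁ … kᵣ times, then e_{k₁}(υ₁) ⋯ e_{kᵣ}(υᵣ) is a
-- symmetric product of generators whose coefficients in degrees ≥ deg t are 1 on the permutations
-- of t and 0 elsewhere: a term u₁ · … · uᵣ, with uᵢ a placement of kᵢ copies of υᵢ, reaches
-- degree deg t only if the uᵢ have disjoint supports, and then uᵢ is recovered from the term by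
-- masking out every entry other than υᵢ. Subtracting (coefficient of t) times this product from a
-- symmetric tensor therefore clears the orbit of t and changes no other coefficient of degree
-- ≥ deg t. Clearing the orbits of all keys of top degree lowers the degree; induction on the
-- degree ends at the zero tensor.

module Submission where

open import Defs
open import Algebra.Bundles using (CommutativeRing)
open import Data.Nat using (ℕ; _≤_)
open import Data.Product using (Σ)
open import Data.Empty using (⊥-elim)
open import Data.Nat.Properties using (<⇒≱)

module Tuples where
  open import Data.Nat using (zero; suc; _+_; _*_; z≤n; s≤s)
  open import Data.Nat.Properties
    using ( ≤-refl; ≤-trans; ≤-reflexive; ≤-antisym; +-mono-≤; +-monoʳ-≤; m≤n+m; +-cancelʳ-≤
          ; +-assoc; +-identityʳ; +-cancelˡ-≡; +-cancelʳ-≡; m+n≡0⇒m≡0; m+n≡0⇒n≡0; 0≢1+n; suc-injective; _≟_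
          ; +-0-commutativeMonoid; +-commutativeSemigroup )
  open import Data.Nat.ListAction using (sum)
  open import Data.Fin using (Fin; zero; suc)
  import Data.Fin as Fin
  open import Data.Fin.Permutation
    using (Permutation′; _⟨$⟩ʳ_; _⟨$⟩ˡ_; _∘ₚ_; flip; inverseʳ; lift₀; transpose) renaming (id to idₚ)
  open import Data.List using (List; []; _∷_; _++_; map; concatMap; deduplicate)
  import Data.List.Properties as List
  open import Data.List.Membership.Propositional using (_∈_; _∉_)
  open import Data.List.Membership.Propositional.Properties using (∈-deduplicate⁻; ∈-deduplicate⁺)
  open import Data.List.Relation.Unary.All as ListAll using ([]; _∷_) renaming (All to ListAll)
  import Data.List.Relation.Unary.All.Properties as ListAll
  open import Data.List.Relation.Unary.AllPairs using ([]; _∷_)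
  open import Data.List.Relation.Unary.Any using (here; there; any?)
  open import Data.List.Relation.Unary.Unique.Propositional using (Unique)
  open import Data.List.Relation.Unary.Unique.DecPropositional.Properties using (deduplicate-!)
  open import Data.Vec using ([]; _∷_; zipWith; replicate; tabulate; lookup; removeAt) renaming (map to mapᵥ)
  import Data.Vec.Properties as Vec
  open import Data.Vec.Relation.Unary.All as Allᵥ using ([]; _∷_) renaming (All to Allᵥ)
  import Data.Vec.Relation.Unary.All.Properties as Allᵥ
  open import Data.Vec.Relation.Binary.Pointwise.Inductive using (Pointwise; []; _∷_)
  open import Data.Product using (∃; _×_; _,_; proj₁; proj₂)
  open import Data.Sum using (_⊎_; inj₁; inj₂; map₂)
  open import Function using (_∘_)
  open import Relation.Nullary using (Dec; yes; no; ¬_)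
  open import Relation.Nullary.Decidable using (_×-dec_; _⊎-dec_)
  open import Relation.Binary.PropositionalEquality
  open import Algebra.Properties.CommutativeMonoid.Sum +-0-commutativeMonoid using (sum-permute) renaming (sum to ∑)
  open import Algebra.Properties.CommutativeSemigroup +-commutativeSemigroup using (interchange; x∙yz≈y∙xz)

  private
    variable
      m n : ℕ

  infix 4 _≟ʷ_
  _≟ʷ_ : (x y : Word m) → Dec (x ≡ y)
  _≟ʷ_ = List.≡-dec Fin._≟_

  when : ∀ {p} {P : Set p} → Dec P → ℕ → ℕ
  when (yes _) a = a
  when (no _) a = 0

  χ : ∀ {p} {P : Set p} → Dec P → ℕ
  χ d = when d 1

  when-yes : ∀ {p} {P : Set p} {a} → P → (d : Dec P) → when d a ≡ a
  when-yes _ (yes _) = refl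
  when-yes p (no ¬p) = ⊥-elim (¬p p)

  when-no : ∀ {p} {P : Set p} {a} → ¬ P → (d : Dec P) → when d a ≡ 0
  when-no ¬p (yes p) = ⊥-elim (¬p p)
  when-no _ (no _) = refl

  χ-cong : ∀ {p q} {P : Set p} {Q : Set q} → (P → Q) → (Q → P) → (d : Dec P) (d′ : Dec Q) → χ d ≡ χ d′
  χ-cong f g (yes p) d′ = sym (when-yes (f p) d′)
  χ-cong f g (no ¬p) d′ = sym (when-no (λ q → ¬p (g q)) d′)

  δʷ : Word m → Word m → ℕ
  δʷ x y = χ (x ≟ʷ y)

  δʷ-refl : (x : Word m) → δʷ x x ≡ 1
  δʷ-refl x = when-yes refl (x ≟ʷ x)

  δʷ-≢ : {x y : Word m} → x ≢ y → δʷ x y ≡ 0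
  δʷ-≢ {x = x} {y} x≢y = when-no x≢y (x ≟ʷ y)

  nonempty : Word m → ℕ
  nonempty [] = 0
  nonempty (_ ∷ _) = 1

  tally : (Word m → ℕ) → Tup m n → ℕ
  tally f [] = 0
  tally f (x ∷ t) = f x + tally f t

  count : Word m → Tup m n → ℕ
  count x = tally (δʷ x)

  degree : Tup m n → ℕ
  degree = tally nonempty

  tally-cong : ∀ {f g : Word m → ℕ} (t : Tup m n) → Allᵥ (λ y → f y ≡ g y) t → tally f t ≡ tally g t
  tally-cong [] [] = refl
  tally-cong (y ∷ t) (p ∷ ps) = cong₂ _+_ p (tally-cong t ps)

  tally-+ : ∀ (f g : Word m → ℕ) (t : Tup m n) → tally (λ y → f y + g y) t ≡ tally f t + tally g t
  tally-+ f g [] = refl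
  tally-+ f g (y ∷ t) = trans (cong (f y + g y +_) (tally-+ f g t)) (interchange (f y) (g y) (tally f t) (tally g t))

  tally-zero : (t : Tup m n) → tally (λ _ → 0) t ≡ 0
  tally-zero [] = refl
  tally-zero (_ ∷ t) = tally-zero t

  tally-one : (t : Tup m n) → tally (λ _ → 1) t ≡ n
  tally-one [] = refl
  tally-one (_ ∷ t) = cong suc (tally-one t)

  tally-≤ : ∀ {f : Word m → ℕ} → (∀ y → f y ≤ 1) → (t : Tup m n) → tally f t ≤ n
  tally-≤ f≤1 [] = z≤n
  tally-≤ f≤1 (y ∷ t) = +-mono-≤ (f≤1 y) (tally-≤ f≤1 t)

  tally-removeAt : ∀ f (t : Tup m (suc n)) i → tally f t ≡ f (lookup t i) + tally f (removeAt t i)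
  tally-removeAt f (x ∷ t) zero = refl
  tally-removeAt f (x ∷ y ∷ t) (suc i) =
    trans (cong (f x +_) (tally-removeAt f (y ∷ t) i))
          (x∙yz≈y∙xz (f x) (f (lookup (y ∷ t) i)) (tally f (removeAt (y ∷ t) i)))

  tally-lookup : ∀ f (t : Tup m n) → tally f t ≡ ∑ (λ j → f (lookup t j))
  tally-lookup f [] = refl
  tally-lookup f (x ∷ t) = cong (f x +_) (tally-lookup f t)

  tally-tabulate : ∀ f (h : Fin n → Word m) → tally f (tabulate h) ≡ ∑ (λ j → f (h j))
  tally-tabulate {zero} f h = refl
  tally-tabulate {suc n} f h = cong (f (h zero) +_) (tally-tabulate f (λ j → h (suc j)))

  tally-permute : ∀ f (σ : Permutation′ n) (t : Tup m n) → tally f (permuteTup σ t) ≡ tally f t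
  tally-permute f σ t = begin
    tally f (permuteTup σ t)            ≡⟨ tally-tabulate f (λ j → lookup t (σ ⟨$⟩ʳ j)) ⟩
    ∑ (λ j → f (lookup t (σ ⟨$⟩ʳ j)))   ≡⟨ sum-permute (λ j → f (lookup t j)) σ ⟨
    ∑ (λ j → f (lookup t j))            ≡⟨ tally-lookup f t ⟨
    tally f t                           ∎
    where open ≡-Reasoning

  count-≤ : (x : Word m) (t : Tup m n) → count x t ≤ n
  count-≤ x = tally-≤ δʷ≤1
    where
    δʷ≤1 : ∀ y → δʷ x y ≤ 1
    δʷ≤1 y with x ≟ʷ y
    ... | yes _ = s≤s z≤n
    ... | no _ = z≤n

  degree-≤ : (t : Tup m n) → degree t ≤ n
  degree-≤ = tally-≤ nonempty≤1
    where
    nonempty≤1 : (y : Word m) → nonempty y ≤ 1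
    nonempty≤1 [] = z≤n
    nonempty≤1 (_ ∷ _) = s≤s z≤n

  count[]+degree : (t : Tup m n) → count [] t + degree t ≡ n
  count[]+degree t = begin
    count [] t + degree t                     ≡⟨ tally-+ (δʷ []) nonempty t ⟨
    tally (λ y → δʷ [] y + nonempty y) t      ≡⟨ tally-cong t (Allᵥ.universal split t) ⟩
    tally (λ _ → 1) t                         ≡⟨ tally-one t ⟩
    _                                         ∎
    where
    open ≡-Reasoning
    split : (y : Word m) → δʷ [] y + nonempty y ≡ 1
    split [] = refl
    split (_ ∷ _) = refl

  degree≡0 : (t : Tup m n) → degree t ≡ 0 → t ≡ replicate n []
  degree≡0 [] _ = refl
  degree≡0 ([] ∷ t) h = cong ([] ∷_) (degree≡0 t h)

  degree-replicate : degree (replicate n ([] {A = Fin m})) ≡ 0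
  degree-replicate {zero} = refl
  degree-replicate {suc n} = degree-replicate {n}

  count-replicate : {x : Word m} → x ≢ [] → count x (replicate n []) ≡ 0
  count-replicate {n = zero} _ = refl
  count-replicate {n = suc n} x≢[] = cong₂ _+_ (δʷ-≢ x≢[]) (count-replicate {n = n} x≢[])

  count≡0 : ∀ {x : Word m} (t : Tup m n) → count x t ≡ 0 → Allᵥ (_≢ x) t
  count≡0 [] _ = []
  count≡0 {x = x} (y ∷ t) h = y≢x ∷ count≡0 t (m+n≡0⇒n≡0 (δʷ x y) h)
    where
    y≢x : y ≢ x
    y≢x refl = 0≢1+n (trans (sym (m+n≡0⇒m≡0 (δʷ x x) h)) (δʷ-refl x))

  lookup-of-count : ∀ (x : Word m) (t : Tup m n) → 1 ≤ count x t → ∃ λ i → lookup t i ≡ x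
  lookup-of-count x [] ()
  lookup-of-count x (y ∷ t) h with x ≟ʷ y
  ... | yes x≡y = zero , sym x≡y
  ... | no _ = let i , tᵢ≡x = lookup-of-count x t h in suc i , tᵢ≡x

  lookup-permuteTup : ∀ (σ : Permutation′ n) (t : Tup m n) i → lookup (permuteTup σ t) i ≡ lookup t (σ ⟨$⟩ʳ i)
  lookup-permuteTup σ t = Vec.lookup∘tabulate _

  permuteTup-∘ : ∀ (σ τ : Permutation′ n) (t : Tup m n) →
    permuteTup σ (permuteTup τ t) ≡ permuteTup (σ ∘ₚ τ) t
  permuteTup-∘ σ τ t = Vec.tabulate-cong (λ j → lookup-permuteTup τ t (σ ⟨$⟩ʳ j))

  permuteTup-inverse : ∀ (σ : Permutation′ n) (t : Tup m n) → permuteTup (flip σ) (permuteTup σ t) ≡ t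
  permuteTup-inverse σ t = trans
    (Vec.tabulate-cong (λ j → trans (lookup-permuteTup σ t (σ ⟨$⟩ˡ j)) (cong (lookup t) (inverseʳ σ))))
    (Vec.tabulate∘lookup t)

  permuteTup-inverse′ : ∀ (σ : Permutation′ n) (t : Tup m n) → permuteTup σ (permuteTup (flip σ) t) ≡ t
  permuteTup-inverse′ σ = permuteTup-inverse (flip σ)

  infix 4 _∼_
  record _∼_ (s t : Tup m n) : Set where
    constructor _,_
    field
      perm : Permutation′ n
      ≡-permuteTup : s ≡ permuteTup perm t

  ∼-refl : (t : Tup m n) → t ∼ t
  ∼-refl t = idₚ , sym (Vec.tabulate∘lookup t)

  ∼-sym : {s t : Tup m n} → s ∼ t → t ∼ s
  ∼-sym {t = t} (σ , refl) = flip σ , sym (permuteTup-inverse σ t)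

  ∼-trans : {s t u : Tup m n} → s ∼ t → t ∼ u → s ∼ u
  ∼-trans {u = u} (σ , refl) (τ , refl) = σ ∘ₚ τ , permuteTup-∘ σ τ u

  ∼-∷ : ∀ x {s t : Tup m n} → s ∼ t → (x ∷ s) ∼ (x ∷ t)
  ∼-∷ x (σ , refl) = lift₀ σ , refl

  ∼-swap : ∀ (x y : Word m) (t : Tup m n) → (x ∷ y ∷ t) ∼ (y ∷ x ∷ t)
  ∼-swap x y t = transpose zero (suc zero) , cong (λ v → x ∷ y ∷ v) (sym (Vec.tabulate∘lookup t))

  ∼-removeAt : ∀ (t : Tup m (suc n)) i → t ∼ (lookup t i ∷ removeAt t i)
  ∼-removeAt (x ∷ t) zero = ∼-refl (x ∷ t)
  ∼-removeAt (x ∷ y ∷ t) (suc i) =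
    ∼-trans (∼-∷ x (∼-removeAt (y ∷ t) i)) (∼-swap x (lookup (y ∷ t) i) (removeAt (y ∷ t) i))

  count⇒∼ : (s t : Tup m n) → (∀ x → count x s ≡ count x t) → s ∼ t
  count⇒∼ [] [] _ = ∼-refl []
  count⇒∼ {n = suc n} (x ∷ s) t same = ∼-trans (∼-∷ x (count⇒∼ s (removeAt t i) same′)) (∼-sym t∼x∷t′)
    where
    x∈t : ∃ λ i → lookup t i ≡ x
    x∈t = lookup-of-count x t (subst (1 ≤_) (same x)
            (subst (λ c → 1 ≤ c + count x s) (sym (δʷ-refl x)) (s≤s z≤n)))
    i : Fin (suc n)
    i = proj₁ x∈t
    t∼x∷t′ : t ∼ (x ∷ removeAt t i)
    t∼x∷t′ = subst (λ y → t ∼ (y ∷ removeAt t i)) (proj₂ x∈t) (∼-removeAt t i)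
    same′ : ∀ y → count y s ≡ count y (removeAt t i)
    same′ y = +-cancelˡ-≡ (δʷ y x) _ _ (begin
      δʷ y x + count y s                             ≡⟨ same y ⟩
      count y t                                      ≡⟨ tally-removeAt (δʷ y) t i ⟩
      δʷ y (lookup t i) + count y (removeAt t i)     ≡⟨ cong (λ z → δʷ y z + count y (removeAt t i)) (proj₂ x∈t) ⟩
      δʷ y x + count y (removeAt t i)                ∎)
      where open ≡-Reasoning

  infixl 7 _·_
  _·_ : Tup m n → Tup m n → Tup m n
  _·_ = zipWith _++_

  ≡-lookup : {u w : Tup m n} → (∀ i → lookup u i ≡ lookup w i) → u ≡ w
  ≡-lookup {u = u} {w} h = trans (sym (Vec.tabulate∘lookup u)) (trans (Vec.tabulate-cong h) (Vec.tabulate∘lookup w))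

  permuteTup-· : ∀ (σ : Permutation′ n) (u w : Tup m n) → permuteTup σ (u · w) ≡ permuteTup σ u · permuteTup σ w
  permuteTup-· σ u w = ≡-lookup λ i → begin
    lookup (permuteTup σ (u · w)) i
      ≡⟨ lookup-permuteTup σ (u · w) i ⟩
    lookup (u · w) (σ ⟨$⟩ʳ i)
      ≡⟨ Vec.lookup-zipWith _++_ (σ ⟨$⟩ʳ i) u w ⟩
    lookup u (σ ⟨$⟩ʳ i) ++ lookup w (σ ⟨$⟩ʳ i)
      ≡⟨ cong₂ _++_ (lookup-permuteTup σ u i) (lookup-permuteTup σ w i) ⟨
    lookup (permuteTup σ u) i ++ lookup (permuteTup σ w) i
      ≡⟨ Vec.lookup-zipWith _++_ i (permuteTup σ u) (permuteTup σ w) ⟨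
    lookup (permuteTup σ u · permuteTup σ w) i
      ∎
    where open ≡-Reasoning

  permuteTup-replicate : ∀ (σ : Permutation′ n) (x : Word m) → permuteTup σ (replicate n x) ≡ replicate n x
  permuteTup-replicate σ x = ≡-lookup λ i →
    trans (lookup-permuteTup σ (replicate _ x) i)
          (trans (Vec.lookup-replicate (σ ⟨$⟩ʳ i) x) (sym (Vec.lookup-replicate i x)))

  replicate-· : (w : Tup m n) → replicate n [] · w ≡ w
  replicate-· [] = refl
  replicate-· (x ∷ w) = cong (x ∷_) (replicate-· w)

  Disjoint : Tup m n → Tup m n → Set
  Disjoint = Pointwise (λ x y → x ≡ [] ⊎ y ≡ [])

  nonempty-++ : (x y : Word m) → nonempty (x ++ y) ≤ nonempty x + nonempty y
  nonempty-++ [] y = ≤-refl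
  nonempty-++ (_ ∷ _) y = s≤s z≤n

  nonempty-++-disjoint : (x y : Word m) → x ≡ [] ⊎ y ≡ [] → nonempty (x ++ y) ≡ nonempty x + nonempty y
  nonempty-++-disjoint [] y _ = refl
  nonempty-++-disjoint (_ ∷ _) [] _ = refl
  nonempty-++-disjoint (_ ∷ _) (_ ∷ _) (inj₁ ())
  nonempty-++-disjoint (_ ∷ _) (_ ∷ _) (inj₂ ())

  nonempty-++-additive : (x y : Word m) → nonempty (x ++ y) ≡ nonempty x + nonempty y → x ≡ [] ⊎ y ≡ []
  nonempty-++-additive [] y _ = inj₁ refl
  nonempty-++-additive (_ ∷ _) [] _ = inj₂ refl

  degree-· : (u w : Tup m n) → degree (u · w) ≤ degree u + degree w
  degree-· [] [] = z≤n
  degree-· (x ∷ u) (y ∷ w) = ≤-trans (+-mono-≤ (nonempty-++ x y) (degree-· u w))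
    (≤-reflexive (interchange (nonempty x) (nonempty y) (degree u) (degree w)))

  degree-·-disjoint : {u w : Tup m n} → Disjoint u w → degree (u · w) ≡ degree u + degree w
  degree-·-disjoint [] = refl
  degree-·-disjoint {u = x ∷ u} {y ∷ w} (x⊥y ∷ u⊥w) =
    trans (cong₂ _+_ (nonempty-++-disjoint x y x⊥y) (degree-·-disjoint u⊥w))
          (interchange (nonempty x) (nonempty y) (degree u) (degree w))

  equal-summands : ∀ {a a′ b b′} → a ≤ a′ → b ≤ b′ → a + b ≡ a′ + b′ → a ≡ a′ × b ≡ b′
  equal-summands {a} {a′} {b} {b′} a≤a′ b≤b′ sum≡ = a≡a′ , +-cancelˡ-≡ a b b′ (trans sum≡ (cong (_+ b′) (sym a≡a′)))
    where
    a≡a′ : a ≡ a′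
    a≡a′ = ≤-antisym a≤a′ (+-cancelʳ-≤ b a′ a (≤-trans (+-monoʳ-≤ a′ b≤b′) (≤-reflexive (sym sum≡))))

  degree-·-additive : (u w : Tup m n) → degree (u · w) ≡ degree u + degree w → Disjoint u w
  degree-·-additive [] [] _ = []
  degree-·-additive (x ∷ u) (y ∷ w) h =
    let x≡ , u≡ = equal-summands (nonempty-++ x y) (degree-· u w)
                    (trans h (interchange (nonempty x) (degree u) (nonempty y) (degree w)))
    in nonempty-++-additive x y x≡ ∷ degree-·-additive u w u≡

  δʷ-++-disjoint : {x : Word m} (a b : Word m) → a ≡ [] ⊎ b ≡ [] → x ≢ [] → δʷ x (a ++ b) ≡ δʷ x a + δʷ x b
  δʷ-++-disjoint a b (inj₁ refl) x≢[] = sym (cong (_+ δʷ _ b) (δʷ-≢ x≢[]))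
  δʷ-++-disjoint {x = x} a b (inj₂ refl) x≢[] =
    trans (cong (δʷ x) (List.++-identityʳ a)) (sym (trans (cong (δʷ x a +_) (δʷ-≢ x≢[])) (+-identityʳ _)))

  count-·-disjoint : {x : Word m} {u w : Tup m n} → Disjoint u w → x ≢ [] → count x (u · w) ≡ count x u + count x w
  count-·-disjoint [] _ = refl
  count-·-disjoint {x = x} {a ∷ u} {b ∷ w} (a⊥b ∷ u⊥w) x≢[] =
    trans (cong₂ _+_ (δʷ-++-disjoint a b a⊥b x≢[]) (count-·-disjoint u⊥w x≢[]))
          (interchange (δʷ x a) (δʷ x b) (count x u) (count x w))

  mask : Word m → Word m → Word m
  mask υ y with y ≟ʷ υ
  ... | yes _ = υ
  ... | no _ = []

  unmask : Word m → Word m → Word m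
  unmask υ y with y ≟ʷ υ
  ... | yes _ = []
  ... | no _ = y

  module _ {υ : Word m} where
    mask-·-unmask : (s : Tup m n) → mapᵥ (mask υ) s · mapᵥ (unmask υ) s ≡ s
    mask-·-unmask [] = refl
    mask-·-unmask (y ∷ s) = cong₂ _∷_ (pointwise y) (mask-·-unmask s)
      where
      pointwise : ∀ y → mask υ y ++ unmask υ y ≡ y
      pointwise y with y ≟ʷ υ
      ... | yes refl = List.++-identityʳ y
      ... | no _ = refl

    mask-unmask-disjoint : (s : Tup m n) → Disjoint (mapᵥ (mask υ) s) (mapᵥ (unmask υ) s)
    mask-unmask-disjoint [] = []
    mask-unmask-disjoint (y ∷ s) = pointwise y ∷ mask-unmask-disjoint s
      where
      pointwise : ∀ y → mask υ y ≡ [] ⊎ unmask υ y ≡ []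
      pointwise y with y ≟ʷ υ
      ... | yes _ = inj₂ refl
      ... | no _ = inj₁ refl

    mask-shape : (s : Tup m n) → Allᵥ (λ x → x ≡ [] ⊎ x ≡ υ) (mapᵥ (mask υ) s)
    mask-shape [] = []
    mask-shape (y ∷ s) = pointwise y ∷ mask-shape s
      where
      pointwise : ∀ y → mask υ y ≡ [] ⊎ mask υ y ≡ υ
      pointwise y with y ≟ʷ υ
      ... | yes _ = inj₂ refl
      ... | no _ = inj₁ refl

    count-mask : υ ≢ [] → (s : Tup m n) → count υ (mapᵥ (mask υ) s) ≡ count υ s
    count-mask υ≢[] [] = refl
    count-mask υ≢[] (y ∷ s) = cong₂ _+_ (pointwise y) (count-mask υ≢[] s)
      where
      pointwise : ∀ y → δʷ υ (mask υ y) ≡ δʷ υ y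
      pointwise y with y ≟ʷ υ
      ... | yes refl = refl
      ... | no y≢υ = trans (δʷ-≢ (λ υ≡[] → υ≢[] υ≡[])) (sym (δʷ-≢ (λ υ≡y → y≢υ (sym υ≡y))))

    mask-unique : υ ≢ [] → {u w : Tup m n} → Allᵥ (λ x → x ≡ [] ⊎ x ≡ υ) u → Allᵥ (_≢ υ) w → Disjoint u w →
      u ≡ mapᵥ (mask υ) (u · w) × w ≡ mapᵥ (unmask υ) (u · w)
    mask-unique υ≢[] [] [] [] = refl , refl
    mask-unique υ≢[] {a ∷ u} {b ∷ w} (a∈ ∷ u∈) (b≢υ ∷ w≢υ) (a⊥b ∷ u⊥w) =
      let a≡ , b≡ = pointwise a b a∈ b≢υ a⊥b
          u≡ , w≡ = mask-unique υ≢[] u∈ w≢υ u⊥w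
      in cong₂ _∷_ a≡ u≡ , cong₂ _∷_ b≡ w≡
      where
      pointwise : ∀ a b → a ≡ [] ⊎ a ≡ υ → b ≢ υ → a ≡ [] ⊎ b ≡ [] → a ≡ mask υ (a ++ b) × b ≡ unmask υ (a ++ b)
      pointwise a b (inj₂ refl) _ (inj₁ υ≡[]) = ⊥-elim (υ≢[] υ≡[])
      pointwise a b (inj₂ refl) _ (inj₂ refl) rewrite List.++-identityʳ a with a ≟ʷ a
      ... | yes _ = refl , refl
      ... | no a≢a = ⊥-elim (a≢a refl)
      pointwise a b (inj₁ refl) b≢υ _ with b ≟ʷ υ
      ... | yes b≡υ = ⊥-elim (b≢υ b≡υ)
      ... | no _ = refl , refl

  countIn : Tup m n → List (Tup m n) → ℕ
  countIn t [] = 0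
  countIn t (s ∷ L) = χ (tup-≟ s t) + countIn t L

  countIn-++ : ∀ (t : Tup m n) L L′ → countIn t (L ++ L′) ≡ countIn t L + countIn t L′
  countIn-++ t [] L′ = refl
  countIn-++ t (s ∷ L) L′ = trans (cong (χ (tup-≟ s t) +_) (countIn-++ t L L′)) (sym (+-assoc (χ (tup-≟ s t)) _ _))

  countIn-∉ : ∀ (t : Tup m n) L → t ∉ L → countIn t L ≡ 0
  countIn-∉ t [] _ = refl
  countIn-∉ t (s ∷ L) t∉ = cong₂ _+_ (when-no (λ s≡t → t∉ (here (sym s≡t))) (tup-≟ s t)) (countIn-∉ t L (t∉ ∘ there))

  countIn-map : ∀ {n′} (f : Tup m n → Tup m n′) {s w′} L → ListAll (λ w → f w ≡ s → w ≡ w′) L → f w′ ≡ s →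
    countIn s (map f L) ≡ countIn w′ L
  countIn-map f [] [] _ = refl
  countIn-map f (w ∷ L) (p ∷ ps) fw′≡s =
    cong₂ _+_ (χ-cong p (λ { refl → fw′≡s }) (tup-≟ (f w) _) (tup-≟ w _)) (countIn-map f L ps fw′≡s)

  countIn-map-∉ : ∀ {n′} (f : Tup m n → Tup m n′) {s} L → ListAll (λ w → f w ≢ s) L → countIn s (map f L) ≡ 0
  countIn-map-∉ f [] [] = refl
  countIn-map-∉ f (w ∷ L) (p ∷ ps) = cong₂ _+_ (when-no p (tup-≟ (f w) _)) (countIn-map-∉ f L ps)

  countIn-concatMap : ∀ {A : Set} (t : Tup m n) (f : A → List (Tup m n)) L →
    countIn t (concatMap f L) ≡ sum (map (λ x → countIn t (f x)) L)
  countIn-concatMap t f [] = refl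
  countIn-concatMap t f (x ∷ L) =
    trans (countIn-++ t (f x) (concatMap f L)) (cong (countIn t (f x) +_) (countIn-concatMap t f L))

  countIn-map-∷ : ∀ x (u : Tup m n) L → countIn (x ∷ u) (map (x ∷_) L) ≡ countIn u L
  countIn-map-∷ x u L = countIn-map (x ∷_) L (ListAll.universal (λ w → Vec.∷-injectiveʳ) L) refl

  countIn-map-∷-≢ : ∀ {x y : Word m} (u : Tup m n) L → x ≢ y → countIn (x ∷ u) (map (y ∷_) L) ≡ 0
  countIn-map-∷-≢ u L x≢y = countIn-map-∉ _ L (ListAll.universal (λ w eq → x≢y (sym (Vec.∷-injectiveˡ eq))) L)

  sum-map-single : ∀ (g : Tup m n → ℕ) u* L → ListAll (λ u → u ≢ u* → g u ≡ 0) L → sum (map g L) ≡ countIn u* L * g u*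
  sum-map-single g u* [] [] = refl
  sum-map-single g u* (u ∷ L) (p ∷ ps) with tup-≟ u u*
  ... | yes refl = cong (g u +_) (sum-map-single g u* L ps)
  ... | no u≢u* = cong₂ _+_ (p u≢u*) (sum-map-single g u* L ps)

  placements : (n j : ℕ) → Word m → List (Tup m n)
  placements zero zero v = [] ∷ []
  placements zero (suc j) v = []
  placements (suc n) zero v = map ([] ∷_) (placements n zero v)
  placements (suc n) (suc j) v = map ([] ∷_) (placements n (suc j) v) ++ map (v ∷_) (placements n j v)

  Placement : Word m → ℕ → Tup m n → Set
  Placement v j u = Allᵥ (λ x → x ≡ [] ⊎ x ≡ v) u × count v u ≡ j

  placement? : ∀ (v : Word m) j (u : Tup m n) → Dec (Placement v j u)
  placement? v j u = Allᵥ.all? (λ x → x ≟ʷ [] ⊎-dec x ≟ʷ v) u ×-dec count v u ≟ j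

  Placement-permute : ∀ {v : Word m} {j} (σ : Permutation′ n) {u} → Placement v j u → Placement v j (permuteTup σ u)
  Placement-permute σ {u} (shape , count≡) =
    Allᵥ.tabulate⁺ (λ i → Allᵥ.lookup⁺ shape (σ ⟨$⟩ʳ i)) , trans (tally-permute _ σ u) count≡

  module _ {v : Word m} (v≢[] : v ≢ []) where
    count-∷-[] : (u : Tup m n) → count v ([] ∷ u) ≡ count v u
    count-∷-[] u = cong (_+ count v u) (δʷ-≢ v≢[])

    count-∷-self : (u : Tup m n) → count v (v ∷ u) ≡ suc (count v u)
    count-∷-self u = cong (_+ count v u) (δʷ-refl v)

    degree-Placement : ∀ {j} {u : Tup m n} → Placement v j u → degree u ≡ j
    degree-Placement {u = u} (shape , count≡) = trans (tally-cong u (Allᵥ.map pointwise shape)) count≡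
      where
      pointwise : ∀ {x} → x ≡ [] ⊎ x ≡ v → nonempty x ≡ δʷ v x
      pointwise (inj₁ refl) = sym (δʷ-≢ v≢[])
      pointwise (inj₂ refl) = trans (nonempty≢[] v≢[]) (sym (δʷ-refl v))
        where
        nonempty≢[] : ∀ {x : Word m} → x ≢ [] → nonempty x ≡ 1
        nonempty≢[] {[]} x≢[] = ⊥-elim (x≢[] refl)
        nonempty≢[] {_ ∷ _} _ = refl

    count-Placement : ∀ {j} {x} {u : Tup m n} → x ≢ [] → Placement v j u → count x u ≡ when (v ≟ʷ x) j
    count-Placement {x = x} {u} x≢[] (shape , count≡) with v ≟ʷ x
    ... | yes refl = count≡
    ... | no v≢x = trans (tally-cong u (Allᵥ.map pointwise shape)) (tally-zero u)
      where
      pointwise : ∀ {y} → y ≡ [] ⊎ y ≡ v → δʷ x y ≡ 0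
      pointwise (inj₁ refl) = δʷ-≢ x≢[]
      pointwise (inj₂ refl) = δʷ-≢ (λ x≡v → v≢x (sym x≡v))

    Placement-∷-[] : ∀ {j} {u : Tup m n} → Placement v j u → Placement v j ([] ∷ u)
    Placement-∷-[] {u = u} (shape , count≡) = inj₁ refl ∷ shape , trans (count-∷-[] u) count≡

    Placement-∷-self : ∀ {j} {u : Tup m n} → Placement v j u → Placement v (suc j) (v ∷ u)
    Placement-∷-self {u = u} (shape , count≡) = inj₂ refl ∷ shape , trans (count-∷-self u) (cong suc count≡)

    placements-Placement : ∀ n j → ListAll (Placement v j) (placements n j v)
    placements-Placement zero zero = ([] , refl) ∷ []
    placements-Placement zero (suc j) = []
    placements-Placement (suc n) zero = ListAll.map⁺ (ListAll.map Placement-∷-[] (placements-Placement n zero))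
    placements-Placement (suc n) (suc j) = ListAll.++⁺
      (ListAll.map⁺ (ListAll.map Placement-∷-[] (placements-Placement n (suc j))))
      (ListAll.map⁺ (ListAll.map Placement-∷-self (placements-Placement n j)))

    countIn-placements-Placement : ∀ j (u : Tup m n) → Placement v j u → countIn u (placements n j v) ≡ 1
    countIn-placements-Placement zero [] _ = refl
    countIn-placements-Placement (suc j) [] (_ , ())
    countIn-placements-Placement {suc n} zero ([] ∷ u) (inj₁ refl ∷ shape , count≡) =
      trans (countIn-map-∷ [] u (placements n zero v))
            (countIn-placements-Placement zero u (shape , trans (sym (count-∷-[] u)) count≡))
    countIn-placements-Placement zero (v ∷ u) (inj₂ refl ∷ shape , count≡) =
      ⊥-elim (0≢1+n (trans (sym count≡) (count-∷-self u)))
    countIn-placements-Placement {suc n} (suc j) ([] ∷ u) (inj₁ refl ∷ shape , count≡) =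
      trans (countIn-++ ([] ∷ u) (map ([] ∷_) (placements n (suc j) v)) _) (cong₂ _+_
        (trans (countIn-map-∷ [] u (placements n (suc j) v))
               (countIn-placements-Placement (suc j) u (shape , trans (sym (count-∷-[] u)) count≡)))
        (countIn-map-∷-≢ u (placements n j v) (v≢[] ∘ sym)))
    countIn-placements-Placement {suc n} (suc j) (v ∷ u) (inj₂ refl ∷ shape , count≡) =
      trans (countIn-++ (v ∷ u) (map ([] ∷_) (placements n (suc j) v)) _) (cong₂ _+_
        (countIn-map-∷-≢ u (placements n (suc j) v) v≢[])
        (trans (countIn-map-∷ v u (placements n j v))
               (countIn-placements-Placement j u (shape , suc-injective (trans (sym (count-∷-self u)) count≡)))))

    countIn-placements : ∀ j (u : Tup m n) → countIn u (placements n j v) ≡ χ (placement? v j u)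
    countIn-placements j u with placement? v j u
    ... | yes p = countIn-placements-Placement j u p
    ... | no ¬p = countIn-∉ u (placements _ j v) (λ u∈ → ¬p (ListAll.lookup (placements-Placement _ j) u∈))

  total : (Word m → ℕ) → List (Word m) → ℕ
  total k [] = 0
  total k (υ ∷ U) = k υ + total k U

  prescribed : (Word m → ℕ) → List (Word m) → Word m → ℕ
  prescribed k [] x = 0
  prescribed k (υ ∷ U) x = when (υ ≟ʷ x) (k υ) + prescribed k U x

  prescribed-∉ : ∀ k (U : List (Word m)) {x} → ListAll (_≢ x) U → prescribed k U x ≡ 0
  prescribed-∉ k [] [] = refl
  prescribed-∉ k (υ ∷ U) (υ≢x ∷ U≢x) = cong₂ _+_ (when-no υ≢x (υ ≟ʷ _)) (prescribed-∉ k U U≢x)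

  prescribed-∈ : ∀ k {U : List (Word m)} {x} → Unique U → x ∈ U → prescribed k U x ≡ k x
  prescribed-∈ k {x ∷ U} (x∉U ∷ _) (here refl) = begin
    when (x ≟ʷ x) (k x) + prescribed k U x
      ≡⟨ cong₂ _+_ (when-yes refl (x ≟ʷ x)) (prescribed-∉ k U (ListAll.map (_∘ sym) x∉U)) ⟩
    k x + 0
      ≡⟨ +-identityʳ (k x) ⟩
    k x
      ∎
    where open ≡-Reasoning
  prescribed-∈ k {υ ∷ U} (υ∉U ∷ uniq) (there x∈U) =
    trans (cong (_+ prescribed k U _) (when-no (ListAll.lookup υ∉U x∈U) (υ ≟ʷ _))) (prescribed-∈ k uniq x∈U)

  module _ (k : Word m → ℕ) where
    terms : List (Word m) → List (Tup m n)
    terms [] = replicate _ [] ∷ []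
    terms (υ ∷ U) = concatMap (λ u → map (u ·_) (terms U)) (placements _ (k υ) υ)

    Matches : List (Word m) → Tup m n → Set
    Matches U s = ∀ x → x ≢ [] → count x s ≡ prescribed k U x

    Admissible : List (Word m) → Tup m n → Set
    Admissible U w = degree w ≤ total k U × (degree w ≡ total k U → Matches U w)

    module _ {υ : Word m} (υ≢[] : υ ≢ []) {U : List (Word m)} {u w : Tup m n}
             (u-placement : Placement υ (k υ) u) (w-admissible : Admissible U w) where
      private
        degree-u : degree u ≡ k υ
        degree-u = degree-Placement υ≢[] u-placement

      top-split : degree (u · w) ≡ k υ + total k U → Disjoint u w × degree w ≡ total k U
      top-split deg = degree-·-additive u w (trans deg (sym sum≡)) , degree-w
        where
        sum≡ : degree u + degree w ≡ k υ + total k U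
        sum≡ = ≤-antisym (+-mono-≤ (≤-reflexive degree-u) (proj₁ w-admissible))
                         (≤-trans (≤-reflexive (sym deg)) (degree-· u w))
        degree-w : degree w ≡ total k U
        degree-w = +-cancelˡ-≡ (k υ) _ _ (trans (cong (_+ degree w) (sym degree-u)) sum≡)

      ·-Admissible : Admissible (υ ∷ U) (u · w)
      ·-Admissible = ≤-trans (degree-· u w) (+-mono-≤ (≤-reflexive degree-u) (proj₁ w-admissible)) , matches
        where
        matches : degree (u · w) ≡ k υ + total k U → Matches (υ ∷ U) (u · w)
        matches deg x x≢[] =
          let u⊥w , degree-w = top-split deg
          in trans (count-·-disjoint u⊥w x≢[])
                   (cong₂ _+_ (count-Placement υ≢[] x≢[] u-placement) (proj₂ w-admissible degree-w x x≢[]))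

    terms-Admissible : ∀ {U} → ListAll (_≢ []) U → ListAll (Admissible U) (terms {n = n} U)
    terms-Admissible {n = n} {U = []} [] =
      (≤-reflexive (degree-replicate {n = n}) , λ _ x x≢[] → count-replicate {n = n} x≢[]) ∷ []
    terms-Admissible {n = n} {U = υ ∷ U} (υ≢[] ∷ U≢[]) = ListAll.concat⁺ (ListAll.map⁺ (ListAll.map
      (λ u-placement → ListAll.map⁺ (ListAll.map (·-Admissible υ≢[] {U = U} u-placement) (terms-Admissible U≢[])))
      (placements-Placement υ≢[] n (k υ))))

    module TopFactor {υ : Word m} (υ≢[] : υ ≢ []) {U : List (Word m)} (U≢υ : ListAll (_≢ υ) U)
                     (s : Tup m n) (deg : degree s ≡ k υ + total k U) (match : Matches (υ ∷ U) s) where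
      head tail : Tup m n
      head = mapᵥ (mask υ) s
      tail = mapᵥ (unmask υ) s

      head·tail : head · tail ≡ s
      head·tail = mask-·-unmask s

      head-placement : Placement υ (k υ) head
      head-placement = mask-shape s , trans (count-mask υ≢[] s) count-υ
        where
        count-υ : count υ s ≡ k υ
        count-υ = trans (match υ υ≢[])
          (trans (cong₂ _+_ (when-yes refl (υ ≟ʷ υ)) (prescribed-∉ k U U≢υ)) (+-identityʳ _))

      degree-tail : degree tail ≡ total k U
      degree-tail = +-cancelˡ-≡ (k υ) _ _ (begin
        k υ + degree tail           ≡⟨ cong (_+ degree tail) (degree-Placement υ≢[] head-placement) ⟨
        degree head + degree tail   ≡⟨ degree-·-disjoint (mask-unmask-disjoint s) ⟨
        degree (head · tail)        ≡⟨ cong degree head·tail ⟩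
        degree s                    ≡⟨ deg ⟩
        k υ + total k U             ∎)
        where open ≡-Reasoning

      matches-tail : Matches U tail
      matches-tail x x≢[] = +-cancelˡ-≡ (when (υ ≟ʷ x) (k υ)) _ _ (begin
        when (υ ≟ʷ x) (k υ) + count x tail   ≡⟨ cong (_+ count x tail) (count-Placement υ≢[] x≢[] head-placement) ⟨
        count x head + count x tail          ≡⟨ count-·-disjoint (mask-unmask-disjoint s) x≢[] ⟨
        count x (head · tail)                ≡⟨ cong (count x) head·tail ⟩
        count x s                            ≡⟨ match x x≢[] ⟩
        prescribed k (υ ∷ U) x               ∎)
        where open ≡-Reasoning

      factor-unique : ∀ {u w} → Placement υ (k υ) u → Admissible U w → u · w ≡ s → u ≡ head × w ≡ tail
      factor-unique {u} {w} u-placement w-admissible refl =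
        let u⊥w , degree-w = top-split υ≢[] {U = U} u-placement w-admissible deg
            count-υ-w = trans (proj₂ w-admissible degree-w υ υ≢[]) (prescribed-∉ k U U≢υ)
        in mask-unique υ≢[] (proj₁ u-placement) (count≡0 w count-υ-w) u⊥w

    countIn-terms-top : ∀ {U} → ListAll (_≢ []) U → Unique U → (s : Tup m n) →
      degree s ≡ total k U → Matches U s → countIn s (terms U) ≡ 1
    countIn-terms-top {n = n} {[]} [] [] s deg _ =
      cong (_+ 0) (when-yes (sym (degree≡0 s deg)) (tup-≟ (replicate n []) s))
    countIn-terms-top {n = n} {υ ∷ U} (υ≢[] ∷ U≢[]) (υ∉U ∷ unique) s deg match = begin
      countIn s (terms (υ ∷ U))
        ≡⟨ countIn-concatMap s (λ u → map (u ·_) (terms U)) (placements n (k υ) υ) ⟩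
      sum (map (λ u → countIn s (map (u ·_) (terms U))) (placements n (k υ) υ))
        ≡⟨ sum-map-single _ head _ (ListAll.map only-head (placements-Placement υ≢[] n (k υ))) ⟩
      countIn head (placements n (k υ) υ) * countIn s (map (head ·_) (terms U))
        ≡⟨ cong₂ _*_ (countIn-placements-Placement υ≢[] (k υ) head head-placement)
                     (countIn-map (head ·_) (terms U)
                        (ListAll.map (λ w-adm → proj₂ ∘ factor-unique head-placement w-adm) U-admissible) head·tail) ⟩
      1 * countIn tail (terms U)
        ≡⟨ cong (1 *_) (countIn-terms-top U≢[] unique tail degree-tail matches-tail) ⟩
      1 ∎
      where
      open ≡-Reasoning
      open TopFactor υ≢[] (ListAll.map (_∘ sym) υ∉U) s deg match
      U-admissible : ListAll (Admissible U) (terms U)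
      U-admissible = terms-Admissible {n = n} U≢[]
      only-head : ∀ {u} → Placement υ (k υ) u → u ≢ head → countIn s (map (u ·_) (terms U)) ≡ 0
      only-head {u} u-placement u≢head = countIn-map-∉ (u ·_) (terms U)
        (ListAll.map (λ w-adm → u≢head ∘ proj₁ ∘ factor-unique u-placement w-adm) U-admissible)

  nonemptyEntries : Tup m n → List (Word m)
  nonemptyEntries [] = []
  nonemptyEntries ([] ∷ t) = nonemptyEntries t
  nonemptyEntries (x@(_ ∷ _) ∷ t) = x ∷ nonemptyEntries t

  ∈-nonemptyEntries : ∀ {y} (t : Tup m n) → y ∈ nonemptyEntries t → y ≢ [] × 1 ≤ count y t
  ∈-nonemptyEntries {y = y} ([] ∷ t) y∈ =
    let y≢[] , y∈t = ∈-nonemptyEntries t y∈ in y≢[] , ≤-trans y∈t (m≤n+m _ (δʷ y []))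
  ∈-nonemptyEntries {y = y} ((a ∷ x) ∷ t) (here refl) =
    (λ ()) , subst (λ c → 1 ≤ c + count y t) (sym (δʷ-refl y)) (s≤s z≤n)
  ∈-nonemptyEntries {y = y} ((a ∷ x) ∷ t) (there y∈) =
    let y≢[] , y∈t = ∈-nonemptyEntries t y∈ in y≢[] , ≤-trans y∈t (m≤n+m _ (δʷ y (a ∷ x)))

  nonemptyEntries-complete : (t : Tup m n) → Allᵥ (λ y → y ≡ [] ⊎ y ∈ nonemptyEntries t) t
  nonemptyEntries-complete [] = []
  nonemptyEntries-complete ([] ∷ t) = inj₁ refl ∷ nonemptyEntries-complete t
  nonemptyEntries-complete ((a ∷ x) ∷ t) = inj₂ (here refl) ∷ Allᵥ.map (map₂ there) (nonemptyEntries-complete t)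

  distinctEntries : Tup m n → List (Word m)
  distinctEntries t = deduplicate _≟ʷ_ (nonemptyEntries t)

  module _ (t : Tup m n) where
    private
      U : List (Word m)
      U = distinctEntries t
      k : Word m → ℕ
      k υ = count υ t

    distinctEntries-unique : Unique U
    distinctEntries-unique = deduplicate-! _≟ʷ_ (nonemptyEntries t)

    ∈-distinctEntries : ∀ {y} → y ∈ U → y ≢ [] × 1 ≤ count y t
    ∈-distinctEntries y∈ = ∈-nonemptyEntries t (∈-deduplicate⁻ _≟ʷ_ (nonemptyEntries t) y∈)

    distinctEntries-nonempty : ListAll (_≢ []) U
    distinctEntries-nonempty = ListAll.tabulate (proj₁ ∘ ∈-distinctEntries)

    distinctEntries-complete : Allᵥ (λ y → y ≡ [] ⊎ y ∈ U) t
    distinctEntries-complete = Allᵥ.map (map₂ (∈-deduplicate⁺ _≟ʷ_)) (nonemptyEntries-complete t)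

    Matches-distinctEntries : Matches k U t
    Matches-distinctEntries x x≢[] with any? (x ≟ʷ_) U
    ... | yes x∈U = sym (prescribed-∈ k distinctEntries-unique x∈U)
    ... | no x∉U = trans (trans (tally-cong t (Allᵥ.map absent distinctEntries-complete)) (tally-zero t))
                         (sym (prescribed-∉ k U (ListAll.map (_∘ sym) (ListAll.¬Any⇒All¬ U x∉U))))
      where
      absent : ∀ {y} → y ≡ [] ⊎ y ∈ U → δʷ x y ≡ 0
      absent (inj₁ refl) = δʷ-≢ x≢[]
      absent (inj₂ y∈U) = δʷ-≢ λ { refl → x∉U y∈U }

    degree-distinctEntries : degree t ≡ total k U
    degree-distinctEntries = begin
      degree t                                ≡⟨ tally-cong t (Allᵥ.map entry distinctEntries-complete) ⟩
      tally (prescribed (λ _ → 1) U) t        ≡⟨ exchange U ⟨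
      total k U                               ∎
      where
      open ≡-Reasoning
      entry : ∀ {y} → y ≡ [] ⊎ y ∈ U → nonempty y ≡ prescribed (λ _ → 1) U y
      entry (inj₁ refl) = sym (prescribed-∉ _ U distinctEntries-nonempty)
      entry {[]} (inj₂ y∈U) = ⊥-elim (proj₁ (∈-distinctEntries y∈U) refl)
      entry {_ ∷ _} (inj₂ y∈U) = sym (prescribed-∈ _ distinctEntries-unique y∈U)
      exchange : ∀ V → total k V ≡ tally (prescribed (λ _ → 1) V) t
      exchange [] = sym (tally-zero t)
      exchange (υ ∷ V) = trans (cong (count υ t +_) (exchange V)) (sym (tally-+ (δʷ υ) (prescribed (λ _ → 1) V) t))

    Matches⇒∼ : ∀ s → degree s ≡ degree t → Matches k U s → s ∼ t
    Matches⇒∼ s deg match = count⇒∼ s t same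
      where
      same : ∀ x → count x s ≡ count x t
      same [] = +-cancelʳ-≡ (degree s) _ _
        (trans (count[]+degree s) (sym (trans (cong (count [] t +_) deg) (count[]+degree t))))
      same x@(_ ∷ _) = trans (match x (λ ())) (sym (Matches-distinctEntries x (λ ())))

module SymmetricTensors {ℓ₁ ℓ₂} (R : CommutativeRing ℓ₁ ℓ₂) (m : ℕ) where
  open import Data.Nat using (zero; suc; _<_; z≤n; s≤s)
  open import Data.Nat.Properties
    using (≤-trans; ≤-antisym; ≤-reflexive; <⇒≤; m≤n⇒m≤1+n; m≤n⇒m<n∨m≡n; 0≢1+n; _≟_)
  open import Level using (_⊔_)
  open import Data.Nat.Induction using (<-wellFounded)
  open import Induction.WellFounded using (Acc; acc)
  open import Data.Fin.Permutation using (Permutation′; flip)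
  open import Data.List using (List; []; _∷_; _++_; map; concatMap; length)
  open import Data.List.Membership.Propositional using (_∉_)
  open import Data.List.Relation.Unary.All as ListAll using ([]; _∷_) renaming (All to ListAll)
  open import Data.List.Relation.Unary.Any using (any?; here; there)
  open import Data.Vec using ([]; _∷_; replicate)
  open import Data.Product using (_×_; _,_; proj₁; proj₂)
  open import Data.Sum using (_⊎_; inj₁; inj₂)
  open import Function using (_∘_)
  open import Relation.Nullary using (yes; no)
  open import Relation.Binary.PropositionalEquality as Eq using (_≡_; _≢_; refl; cong; subst)

  open Tuples
  open CommutativeRing R hiding (zero) renaming (Carrier to K; refl to ≈-refl; sym to ≈-sym; trans to ≈-trans)
  open import Relation.Binary.Reasoning.Setoid setoid
  open import Algebra.Properties.Monoid.Mult +-monoid using (×-homo-1; ×-homo-+) renaming (_×_ to _×ᴷ_)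
  open import Algebra.Properties.CommutativeSemigroup +-commutativeSemigroup using (x∙yz≈y∙xz)
  open import Algebra.Properties.Ring ring using (-1*x≈-x)

  private
    variable
      n : ℕ

  sumOver : ∀ {a} {A : Set a} → (A → K) → List A → K
  sumOver G [] = 0#
  sumOver G (x ∷ L) = G x + sumOver G L

  sumOver-cong : ∀ {a} {A : Set a} (L : List A) {G H : A → K} → (∀ x → G x ≈ H x) → sumOver G L ≈ sumOver H L
  sumOver-cong [] _ = ≈-refl
  sumOver-cong (x ∷ L) G≈H = +-cong (G≈H x) (sumOver-cong L G≈H)

  sumOver-++ : ∀ {a} {A : Set a} (L L′ : List A) (G : A → K) → sumOver G (L ++ L′) ≈ sumOver G L + sumOver G L′
  sumOver-++ [] L′ G = ≈-sym (+-identityˡ _)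
  sumOver-++ (x ∷ L) L′ G = ≈-trans (+-congˡ (sumOver-++ L L′ G)) (≈-sym (+-assoc _ _ _))

  sumOver-map : ∀ {a b} {A : Set a} {B : Set b} (f : A → B) (L : List A) (G : B → K) →
    sumOver G (map f L) ≈ sumOver (G ∘ f) L
  sumOver-map f [] G = ≈-refl
  sumOver-map f (x ∷ L) G = +-congˡ (sumOver-map f L G)

  sumOver-concatMap : ∀ {a b} {A : Set a} {B : Set b} (f : A → List B) (L : List A) (G : B → K) →
    sumOver G (concatMap f L) ≈ sumOver (sumOver G ∘ f) L
  sumOver-concatMap f [] G = ≈-refl
  sumOver-concatMap f (x ∷ L) G = ≈-trans (sumOver-++ (f x) (concatMap f L) G) (+-congˡ (sumOver-concatMap f L G))

  pair : Tensor R m n → (Tup m n → K) → K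
  pair a G = sumOver (λ kt → proj₁ kt * G (proj₂ kt)) a

  pair-cong : (a : Tensor R m n) {G H : Tup m n → K} → (∀ t → G t ≈ H t) → pair a G ≈ pair a H
  pair-cong a G≈H = sumOver-cong a (λ kt → *-congˡ (G≈H (proj₂ kt)))

  pair-++ : (a b : Tensor R m n) (G : Tup m n → K) → pair (a ++ b) G ≈ pair a G + pair b G
  pair-++ a b G = sumOver-++ a b _

  pair-map : ∀ {n′} (h : K × Tup m n → K × Tup m n′) (f : Tup m n → Tup m n′) →
    (∀ d t → h (d , t) ≡ (d , f t)) → (a : Tensor R m n) (G : Tup m n′ → K) → pair (map h a) G ≈ pair a (G ∘ f)
  pair-map h f h≡ [] G = ≈-refl
  pair-map h f h≡ ((d , t) ∷ a) G rewrite h≡ d t = +-congˡ (pair-map h f h≡ a G)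

  pair-map-scaled : ∀ {n′} (h : K × Tup m n → K × Tup m n′) (r : K) (f : Tup m n → Tup m n′) →
    (∀ d t → h (d , t) ≡ (r * d , f t)) → (a : Tensor R m n) (G : Tup m n′ → K) → pair (map h a) G ≈ r * pair a (G ∘ f)
  pair-map-scaled h r f h≡ [] G = ≈-sym (zeroʳ r)
  pair-map-scaled h r f h≡ ((d , t) ∷ a) G rewrite h≡ d t =
    ≈-trans (+-cong (*-assoc r d _) (pair-map-scaled h r f h≡ a G)) (≈-sym (distribˡ r _ _))

  pair-scaleT : ∀ r (a : Tensor R m n) G → pair (scaleT R m r a) G ≈ r * pair a G
  pair-scaleT r = pair-map-scaled _ r (λ t → t) (λ _ _ → refl)

  pair-mulT : (a b : Tensor R m n) (G : Tup m n → K) → pair (mulT R m a b) G ≈ pair a (λ u → pair b (λ w → G (u · w)))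
  pair-mulT [] b G = ≈-refl
  pair-mulT ((r , u) ∷ a) b G =
    ≈-trans (pair-++ (map _ b) (mulT R m a b) G)
            (+-cong (pair-map-scaled _ r (u ·_) (λ _ _ → refl) b G) (pair-mulT a b G))

  pair-e : ∀ n j (v : Word m) G → pair (e R m n j (mono R m v)) G ≈ sumOver G (placements n j v)
  pair-e zero zero v G = +-congʳ (*-identityˡ _)
  pair-e zero (suc j) v G = ≈-refl
  pair-e (suc n) zero v G = begin
    pair (map _ eₙ) G                              ≈⟨ pair-map _ ([] ∷_) (λ _ _ → refl) eₙ G ⟩
    pair eₙ (G ∘ ([] ∷_))                          ≈⟨ pair-e n zero v (G ∘ ([] ∷_)) ⟩
    sumOver (G ∘ ([] ∷_)) (placements n zero v)    ≈⟨ sumOver-map ([] ∷_) (placements n zero v) G ⟨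
    sumOver G (placements (suc n) zero v)          ∎
    where
    eₙ : Tensor R m n
    eₙ = e R m n zero (mono R m v)
  pair-e (suc n) (suc j) v G = begin
    pair (map _ eₙ⁺ ++ (map _ eₙ ++ [])) G
      ≈⟨ ≈-trans (pair-++ (map _ eₙ⁺) _ G) (+-congˡ (≈-trans (pair-++ (map _ eₙ) [] G) (+-identityʳ _))) ⟩
    pair (map _ eₙ⁺) G + pair (map _ eₙ) G
      ≈⟨ +-cong (pair-map _ ([] ∷_) (λ _ _ → refl) eₙ⁺ G)
                (≈-trans (pair-map-scaled _ 1# (v ∷_) (λ _ _ → refl) eₙ G) (*-identityˡ _)) ⟩
    pair eₙ⁺ (G ∘ ([] ∷_)) + pair eₙ (G ∘ (v ∷_))
      ≈⟨ +-cong (pair-e n (suc j) v _) (pair-e n j v _) ⟩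
    sumOver (G ∘ ([] ∷_)) (placements n (suc j) v) + sumOver (G ∘ (v ∷_)) (placements n j v)
      ≈⟨ +-cong (sumOver-map ([] ∷_) (placements n (suc j) v) G) (sumOver-map (v ∷_) (placements n j v) G) ⟨
    sumOver G (map ([] ∷_) (placements n (suc j) v)) + sumOver G (map (v ∷_) (placements n j v))
      ≈⟨ sumOver-++ (map ([] ∷_) (placements n (suc j) v)) _ G ⟨
    sumOver G (placements (suc n) (suc j) v)
      ∎
    where
    eₙ⁺ eₙ : Tensor R m n
    eₙ⁺ = e R m n (suc j) (mono R m v)
    eₙ = e R m n j (mono R m v)

  δ : Tup m n → Tup m n → K
  δ t s with tup-≟ s t
  ... | yes _ = 1#
  ... | no _ = 0#

  coeff-pair : (a : Tensor R m n) (t : Tup m n) → coeff R m a t ≈ pair a (δ t)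
  coeff-pair [] t = ≈-refl
  coeff-pair ((r , s) ∷ a) t with tup-≟ s t
  ... | yes _ = +-cong (≈-sym (*-identityʳ r)) (coeff-pair a t)
  ... | no _ = ≈-trans (coeff-pair a t) (≈-sym (≈-trans (+-congʳ (zeroʳ r)) (+-identityˡ _)))

  sumOver-δ : (t : Tup m n) (L : List (Tup m n)) → sumOver (δ t) L ≈ countIn t L ×ᴷ 1#
  sumOver-δ t [] = ≈-refl
  sumOver-δ t (s ∷ L) = ≈-trans (+-cong δ-χ (sumOver-δ t L)) (≈-sym (×-homo-+ 1# (χ (tup-≟ s t)) (countIn t L)))
    where
    δ-χ : δ t s ≈ χ (tup-≟ s t) ×ᴷ 1#
    δ-χ with tup-≟ s t
    ... | yes _ = ≈-sym (×-homo-1 1#)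
    ... | no _ = ≈-refl

  coeff-e : ∀ {v : Word m} → v ≢ [] → ∀ j (u : Tup m n) →
    coeff R m (e R m n j (mono R m v)) u ≈ χ (placement? v j u) ×ᴷ 1#
  coeff-e {n = n} {v} v≢[] j u = begin
    coeff R m (e R m n j (mono R m v)) u          ≈⟨ coeff-pair (e R m n j (mono R m v)) u ⟩
    pair (e R m n j (mono R m v)) (δ u)           ≈⟨ pair-e n j v (δ u) ⟩
    sumOver (δ u) (placements n j v)              ≈⟨ sumOver-δ u (placements n j v) ⟩
    countIn u (placements n j v) ×ᴷ 1#            ≡⟨ cong (_×ᴷ 1#) (countIn-placements v≢[] j u) ⟩
    χ (placement? v j u) ×ᴷ 1#                    ∎

  e-symmetric : ∀ {v : Word m} → v ≢ [] → ∀ j → IsSymmetric R m (e R m n j (mono R m v))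
  e-symmetric {v = v} v≢[] j σ u = begin
    coeff R m (e R m _ j (mono R m v)) (permuteTup σ u)   ≈⟨ coeff-e v≢[] j (permuteTup σ u) ⟩
    χ (placement? v j (permuteTup σ u)) ×ᴷ 1#
      ≡⟨ cong (_×ᴷ 1#) (χ-cong backward (Placement-permute σ) (placement? v j (permuteTup σ u)) (placement? v j u)) ⟩
    χ (placement? v j u) ×ᴷ 1#                            ≈⟨ coeff-e v≢[] j u ⟨
    coeff R m (e R m _ j (mono R m v)) u                  ∎
    where
    backward : Placement v j (permuteTup σ u) → Placement v j u
    backward p = subst (Placement v j) (permuteTup-inverse σ u) (Placement-permute (flip σ) p)

  erase : Tup m n → Tensor R m n → Tensor R m n
  erase s [] = []
  erase s ((r , u) ∷ a) with tup-≟ u s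
  ... | yes _ = erase s a
  ... | no _ = (r , u) ∷ erase s a

  pair-erase : (a : Tensor R m n) (s : Tup m n) (G : Tup m n → K) → pair a G ≈ coeff R m a s * G s + pair (erase s a) G
  pair-erase [] s G = ≈-sym (≈-trans (+-identityʳ _) (zeroˡ _))
  pair-erase ((r , u) ∷ a) s G with tup-≟ u s
  ... | yes refl =
    ≈-trans (+-congˡ (pair-erase a u G)) (≈-trans (≈-sym (+-assoc _ _ _)) (+-congʳ (≈-sym (distribʳ _ r _))))
  ... | no _ = ≈-trans (+-congˡ (pair-erase a s G)) (x∙yz≈y∙xz _ _ _)

  coeff-erase-≢ : (a : Tensor R m n) {s t : Tup m n} → t ≢ s → coeff R m (erase s a) t ≈ coeff R m a t
  coeff-erase-≢ [] _ = ≈-refl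
  coeff-erase-≢ ((r , u) ∷ a) {s} {t} t≢s with tup-≟ u s
  ... | yes refl with tup-≟ u t
  ...   | yes refl = ⊥-elim (t≢s refl)
  ...   | no _ = coeff-erase-≢ a t≢s
  coeff-erase-≢ ((r , u) ∷ a) {s} {t} t≢s | no _ with tup-≟ u t
  ...   | yes _ = +-congˡ (coeff-erase-≢ a t≢s)
  ...   | no _ = coeff-erase-≢ a t≢s

  coeff-erase-self : (a : Tensor R m n) (s : Tup m n) → coeff R m (erase s a) s ≈ 0#
  coeff-erase-self [] s = ≈-refl
  coeff-erase-self ((r , u) ∷ a) s with tup-≟ u s
  ... | yes _ = coeff-erase-self a s
  ... | no u≢s with tup-≟ u s
  ...   | yes u≡s = ⊥-elim (u≢s u≡s)
  ...   | no _ = coeff-erase-self a s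

  length-erase : (a : Tensor R m n) (s : Tup m n) → length (erase s a) ≤ length a
  length-erase [] s = z≤n
  length-erase ((r , u) ∷ a) s with tup-≟ u s
  ... | yes _ = m≤n⇒m≤1+n (length-erase a s)
  ... | no _ = s≤s (length-erase a s)

  length-erase-head : ∀ r s (a : Tensor R m n) → length (erase s ((r , s) ∷ a)) < length ((r , s) ∷ a)
  length-erase-head r s a with tup-≟ s s
  ... | yes _ = s≤s (length-erase a s)
  ... | no s≢s = ⊥-elim (s≢s refl)

  pair-zero : (a : Tensor R m n) → (∀ t → coeff R m a t ≈ 0#) → ∀ G → pair a G ≈ 0#
  pair-zero a = go a (<-wellFounded (length a))
    where
    go : ∀ a → Acc _<_ (length a) → (∀ t → coeff R m a t ≈ 0#) → ∀ G → pair a G ≈ 0#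
    go [] _ _ _ = ≈-refl
    go ((r , s) ∷ a) (acc smaller) vanish G = begin
      pair ((r , s) ∷ a) G
        ≈⟨ pair-erase ((r , s) ∷ a) s G ⟩
      coeff R m ((r , s) ∷ a) s * G s + pair (erase s ((r , s) ∷ a)) G
        ≈⟨ +-cong (≈-trans (*-congʳ (vanish s)) (zeroˡ _)) rest ⟩
      0# + 0#
        ≈⟨ +-identityˡ 0# ⟩
      0#
        ∎
      where
      rest : pair (erase s ((r , s) ∷ a)) G ≈ 0#
      rest = go (erase s ((r , s) ∷ a)) (smaller (length-erase-head r s a)) erased-vanish G
        where
        erased-vanish : ∀ t → coeff R m (erase s ((r , s) ∷ a)) t ≈ 0#
        erased-vanish t with tup-≟ t s
        ... | yes refl = coeff-erase-self ((r , s) ∷ a) s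
        ... | no t≢s = ≈-trans (coeff-erase-≢ ((r , s) ∷ a) t≢s) (vanish t)

  coeff-++ : (a b : Tensor R m n) (t : Tup m n) → coeff R m (a ++ b) t ≈ coeff R m a t + coeff R m b t
  coeff-++ a b t = begin
    coeff R m (a ++ b) t              ≈⟨ coeff-pair (a ++ b) t ⟩
    pair (a ++ b) (δ t)               ≈⟨ pair-++ a b (δ t) ⟩
    pair a (δ t) + pair b (δ t)       ≈⟨ +-cong (coeff-pair a t) (coeff-pair b t) ⟨
    coeff R m a t + coeff R m b t     ∎

  coeff-scaleT : ∀ r (a : Tensor R m n) (t : Tup m n) → coeff R m (scaleT R m r a) t ≈ r * coeff R m a t
  coeff-scaleT r a t = begin
    coeff R m (scaleT R m r a) t      ≈⟨ coeff-pair (scaleT R m r a) t ⟩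
    pair (scaleT R m r a) (δ t)       ≈⟨ pair-scaleT r a (δ t) ⟩
    r * pair a (δ t)                  ≈⟨ *-congˡ (coeff-pair a t) ⟨
    r * coeff R m a t                 ∎

  x-cy+cy≈x : ∀ x c y → x + (- c) * y + c * y ≈ x
  x-cy+cy≈x x c y = begin
    x + (- c) * y + c * y       ≈⟨ +-assoc x _ _ ⟩
    x + ((- c) * y + c * y)     ≈⟨ +-congˡ (distribʳ y (- c) c) ⟨
    x + (- c + c) * y           ≈⟨ +-congˡ (≈-trans (*-congʳ (-‿inverseˡ c)) (zeroˡ y)) ⟩
    x + 0#                      ≈⟨ +-identityʳ x ⟩
    x                           ∎

  pair-≈T : {a b : Tensor R m n} → _≈T_ R m a b → ∀ G → pair a G ≈ pair b G
  pair-≈T {n} {a} {b} a≈b G = begin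
    pair a G                                          ≈⟨ x-cy+cy≈x _ 1# _ ⟨
    pair a G + (- 1#) * pair b G + 1# * pair b G      ≈⟨ +-cong difference-zero (*-identityˡ _) ⟩
    0# + pair b G                                     ≈⟨ +-identityˡ _ ⟩
    pair b G                                          ∎
    where
    difference : Tensor R m n
    difference = a ++ scaleT R m (- 1#) b
    difference-vanishes : ∀ t → coeff R m difference t ≈ 0#
    difference-vanishes t = begin
      coeff R m difference t                          ≈⟨ ≈-trans (coeff-++ a _ t) (+-congˡ (coeff-scaleT (- 1#) b t)) ⟩
      coeff R m a t + (- 1#) * coeff R m b t          ≈⟨ +-cong (a≈b t) (-1*x≈-x _) ⟩
      coeff R m b t - coeff R m b t                   ≈⟨ -‿inverseʳ _ ⟩
      0#                                              ∎
    difference-zero : pair a G + (- 1#) * pair b G ≈ 0#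
    difference-zero = begin
      pair a G + (- 1#) * pair b G                    ≈⟨ +-congˡ (pair-scaleT (- 1#) b G) ⟨
      pair a G + pair (scaleT R m (- 1#) b) G         ≈⟨ pair-++ a _ G ⟨
      pair difference G                               ≈⟨ pair-zero difference difference-vanishes G ⟩
      0#                                              ∎

  -- Unlike IsSymmetric, this form of symmetry is visibly closed under mulT; pair-≈T makes the two agree.
  PairSymmetric : Tensor R m n → Set (ℓ₁ ⊔ ℓ₂)
  PairSymmetric {n} a = ∀ (σ : Permutation′ n) (G : Tup m n → K) → pair a (G ∘ permuteTup σ) ≈ pair a G

  δ-cong : {s t s′ t′ : Tup m n} → (s ≡ t → s′ ≡ t′) → (s′ ≡ t′ → s ≡ t) → δ t s ≡ δ t′ s′
  δ-cong {s = s} {t} {s′} {t′} to from with tup-≟ s t | tup-≟ s′ t′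
  ... | yes _ | yes _ = refl
  ... | yes s≡t | no s′≢t′ = ⊥-elim (s′≢t′ (to s≡t))
  ... | no s≢t | yes s′≡t′ = ⊥-elim (s≢t (from s′≡t′))
  ... | no _ | no _ = refl

  δ-permute : ∀ (σ : Permutation′ n) (t s : Tup m n) → δ t (permuteTup σ s) ≡ δ (permuteTup (flip σ) t) s
  δ-permute σ t s = δ-cong
    (λ σs≡t → Eq.trans (Eq.sym (permuteTup-inverse σ s)) (cong (permuteTup (flip σ)) σs≡t))
    (λ s≡σ⁻¹t → Eq.trans (cong (permuteTup σ) s≡σ⁻¹t) (permuteTup-inverse′ σ t))

  IsSymmetric⇒PairSymmetric : (a : Tensor R m n) → IsSymmetric R m a → PairSymmetric a
  IsSymmetric⇒PairSymmetric {n} a a-sym σ G = begin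
    pair a (G ∘ permuteTup σ)       ≈⟨ pair-map act (permuteTup σ) (λ _ _ → refl) a G ⟨
    pair (map act a) G              ≈⟨ pair-≈T {a = map act a} {a} moved≈a G ⟩
    pair a G                        ∎
    where
    act : K × Tup m n → K × Tup m n
    act (r , s) = r , permuteTup σ s
    moved≈a : _≈T_ R m (map act a) a
    moved≈a t = begin
      coeff R m (map act a) t                      ≈⟨ coeff-pair (map act a) t ⟩
      pair (map act a) (δ t)                       ≈⟨ pair-map act (permuteTup σ) (λ _ _ → refl) a (δ t) ⟩
      pair a (δ t ∘ permuteTup σ)                  ≈⟨ pair-cong a (λ s → reflexive (δ-permute σ t s)) ⟩
      pair a (δ (permuteTup (flip σ) t))           ≈⟨ coeff-pair a (permuteTup (flip σ) t) ⟨
      coeff R m a (permuteTup (flip σ) t)          ≈⟨ a-sym (flip σ) t ⟩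
      coeff R m a t                                ∎

  PairSymmetric⇒IsSymmetric : (a : Tensor R m n) → PairSymmetric a → IsSymmetric R m a
  PairSymmetric⇒IsSymmetric a a-sym σ t = begin
    coeff R m a (permuteTup σ t)                 ≈⟨ coeff-pair a (permuteTup σ t) ⟩
    pair a (δ (permuteTup σ t))                  ≈⟨ pair-cong a (λ s → reflexive (δ-permute (flip σ) t s)) ⟨
    pair a (δ t ∘ permuteTup (flip σ))           ≈⟨ a-sym (flip σ) (δ t) ⟩
    pair a (δ t)                                 ≈⟨ coeff-pair a t ⟨
    coeff R m a t                                ∎

  PairSymmetric-mulT : (a b : Tensor R m n) → PairSymmetric a → PairSymmetric b → PairSymmetric (mulT R m a b)
  PairSymmetric-mulT a b a-sym b-sym σ G = begin
    pair (mulT R m a b) (G ∘ permuteTup σ)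
      ≈⟨ pair-mulT a b _ ⟩
    pair a (λ u → pair b (λ w → G (permuteTup σ (u · w))))
      ≈⟨ pair-cong a (λ u → pair-cong b (λ w → reflexive (cong G (permuteTup-· σ u w)))) ⟩
    pair a (λ u → pair b (λ w → G (permuteTup σ u · permuteTup σ w)))
      ≈⟨ pair-cong a (λ u → b-sym σ (λ w → G (permuteTup σ u · w))) ⟩
    pair a (λ u → pair b (λ w → G (permuteTup σ u · w)))
      ≈⟨ a-sym σ (λ u → pair b (λ w → G (u · w))) ⟩
    pair a (λ u → pair b (λ w → G (u · w)))
      ≈⟨ pair-mulT a b G ⟨
    pair (mulT R m a b) G
      ∎

  PairSymmetric-unit : ∀ r → PairSymmetric {n} (scaleT R m r (oneT R m))
  PairSymmetric-unit r σ G = +-congʳ (*-congˡ (reflexive (cong G (permuteTup-replicate σ []))))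

  eProduct : (Word m → ℕ) → List (Word m) → Tensor R m n
  eProduct k [] = scaleT R m 1# (oneT R m)
  eProduct {n} k (υ ∷ U) = mulT R m (e R m n (k υ) (mono R m υ)) (eProduct k U)

  pair-eProduct : ∀ k U (G : Tup m n → K) → pair (eProduct k U) G ≈ sumOver G (terms k U)
  pair-eProduct k [] G = +-congʳ (≈-trans (*-congʳ (*-identityˡ 1#)) (*-identityˡ _))
  pair-eProduct {n} k (υ ∷ U) G = begin
    pair (mulT R m eᵥ (eProduct k U)) G
      ≈⟨ pair-mulT eᵥ (eProduct k U) G ⟩
    pair eᵥ (λ u → pair (eProduct k U) (λ w → G (u · w)))
      ≈⟨ pair-cong eᵥ (λ u → pair-eProduct k U (λ w → G (u · w))) ⟩
    pair eᵥ (λ u → sumOver (λ w → G (u · w)) (terms k U))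
      ≈⟨ pair-e n (k υ) υ _ ⟩
    sumOver (λ u → sumOver (λ w → G (u · w)) (terms k U)) placementsᵥ
      ≈⟨ sumOver-cong placementsᵥ (λ u → sumOver-map (u ·_) (terms k U) G) ⟨
    sumOver (λ u → sumOver G (map (u ·_) (terms k U))) placementsᵥ
      ≈⟨ sumOver-concatMap (λ u → map (u ·_) (terms k U)) placementsᵥ G ⟨
    sumOver G (terms k (υ ∷ U))
      ∎
    where
    eᵥ : Tensor R m n
    eᵥ = e R m n (k υ) (mono R m υ)
    placementsᵥ : List (Tup m n)
    placementsᵥ = placements n (k υ) υ

  coeff-eProduct : ∀ k U (s : Tup m n) → coeff R m (eProduct k U) s ≈ countIn s (terms k U) ×ᴷ 1#
  coeff-eProduct k U s =
    ≈-trans (coeff-pair (eProduct k U) s) (≈-trans (pair-eProduct k U (δ s)) (sumOver-δ s (terms k U)))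

  eProduct-symmetric : ∀ k {U} → ListAll (_≢ []) U → IsSymmetric R m (eProduct {n} k U)
  eProduct-symmetric {n} k {U} nonempty = PairSymmetric⇒IsSymmetric (eProduct k U) (pairSymmetric nonempty)
    where
    pairSymmetric : ∀ {U} → ListAll (_≢ []) U → PairSymmetric (eProduct k U)
    pairSymmetric [] = PairSymmetric-unit 1#
    pairSymmetric {υ ∷ U} (υ≢[] ∷ nonempty) = PairSymmetric-mulT eᵥ (eProduct k U)
      (IsSymmetric⇒PairSymmetric eᵥ (e-symmetric υ≢[] (k υ))) (pairSymmetric nonempty)
      where
      eᵥ : Tensor R m n
      eᵥ = e R m n (k υ) (mono R m υ)

  module _ (t : Tup m n) where
    private
      k : Word m → ℕ
      k υ = count υ t
      U : List (Word m)
      U = distinctEntries t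
      degree-t : degree t ≡ total k U
      degree-t = degree-distinctEntries t
      termsₜ : List (Tup m n)
      termsₜ = terms k U

    orbitProduct : Tensor R m n
    orbitProduct = eProduct k U

    orbitProduct-symmetric : IsSymmetric R m orbitProduct
    orbitProduct-symmetric = eProduct-symmetric k (distinctEntries-nonempty t)

    countIn-terms-orbit : ∀ s → degree s ≡ degree t → Matches k U s → countIn s termsₜ ≡ 1
    countIn-terms-orbit s deg =
      countIn-terms-top k (distinctEntries-nonempty t) (distinctEntries-unique t) s (Eq.trans deg degree-t)

    orbitProduct-top : ∀ s → degree t ≤ degree s →
      (s ∼ t × coeff R m orbitProduct s ≈ 1#) ⊎ (s ≢ t × coeff R m orbitProduct s ≈ 0#)
    orbitProduct-top s deg≤ with any? (tup-≟ s) termsₜ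
    ... | yes s∈terms = inj₁ (Matches⇒∼ t s degree-s matches-s , (begin
      coeff R m orbitProduct s   ≈⟨ coeff-eProduct k U s ⟩
      countIn s termsₜ ×ᴷ 1#     ≡⟨ cong (_×ᴷ 1#) (countIn-terms-orbit s degree-s matches-s) ⟩
      1 ×ᴷ 1#                    ≈⟨ ×-homo-1 1# ⟩
      1#                         ∎))
      where
      admissible : Admissible k U s
      admissible = ListAll.lookup (terms-Admissible k (distinctEntries-nonempty t)) s∈terms
      degree-s : degree s ≡ degree t
      degree-s = ≤-antisym (≤-trans (proj₁ admissible) (≤-reflexive (Eq.sym degree-t))) deg≤
      matches-s : Matches k U s
      matches-s = proj₂ admissible (Eq.trans degree-s degree-t)
    ... | no s∉terms = inj₂ (s≢t , ≈-trans (coeff-eProduct k U s) (reflexive (cong (_×ᴷ 1#) absent)))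
      where
      absent : countIn s termsₜ ≡ 0
      absent = countIn-∉ s termsₜ s∉terms
      s≢t : s ≢ t
      s≢t refl = 0≢1+n (Eq.trans (Eq.sym absent) (countIn-terms-orbit t refl (Matches-distinctEntries t)))

  Generated : Tensor R m n → Set (ℓ₁ ⊔ ℓ₂)
  Generated {n} a = Σ (GenExpr R m n) (λ x → _≈T_ R m (eval R m x) a)

  Generated-resp : {a b : Tensor R m n} → _≈T_ R m a b → Generated a → Generated b
  Generated-resp a≈b (x , x≈a) = x , λ t → ≈-trans (x≈a t) (a≈b t)

  Generated-++ : {a b : Tensor R m n} → Generated a → Generated b → Generated (a ++ b)
  Generated-++ {a = a} {b} (x , x≈a) (y , y≈b) = plus x y , λ t → begin
    coeff R m (eval R m x ++ eval R m y) t          ≈⟨ coeff-++ (eval R m x) (eval R m y) t ⟩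
    coeff R m (eval R m x) t + coeff R m (eval R m y) t ≈⟨ +-cong (x≈a t) (y≈b t) ⟩
    coeff R m a t + coeff R m b t                   ≈⟨ coeff-++ a b t ⟨
    coeff R m (a ++ b) t                            ∎

  coeff-unit-mulT : ∀ r (a : Tensor R m n) t → coeff R m (mulT R m (scaleT R m r (oneT R m)) a) t ≈ r * coeff R m a t
  coeff-unit-mulT {n} r a t = begin
    coeff R m (mulT R m r1 a) t
      ≈⟨ coeff-pair (mulT R m r1 a) t ⟩
    pair (mulT R m r1 a) (δ t)
      ≈⟨ pair-mulT r1 a (δ t) ⟩
    r * 1# * pair a (λ w → δ t (replicate n [] · w)) + 0#
      ≈⟨ +-identityʳ _ ⟩
    r * 1# * pair a (λ w → δ t (replicate n [] · w))
      ≈⟨ *-cong (*-identityʳ r) (pair-cong a (λ w → reflexive (cong (δ t) (replicate-· w)))) ⟩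
    r * pair a (δ t)
      ≈⟨ *-congˡ (coeff-pair a t) ⟨
    r * coeff R m a t
      ∎
    where
    r1 : Tensor R m n
    r1 = scaleT R m r (oneT R m)

  Generated-scale : ∀ r {a : Tensor R m n} → Generated a → Generated (scaleT R m r a)
  Generated-scale r {a} (x , x≈a) = times (scal r) x , λ t → begin
    coeff R m (mulT R m (scaleT R m r (oneT R m)) (eval R m x)) t  ≈⟨ coeff-unit-mulT r (eval R m x) t ⟩
    r * coeff R m (eval R m x) t                                   ≈⟨ *-congˡ (x≈a t) ⟩
    r * coeff R m a t                                              ≈⟨ coeff-scaleT r a t ⟨
    coeff R m (scaleT R m r a) t                                   ∎

  Generated-zero : {a : Tensor R m n} → (∀ t → coeff R m a t ≈ 0#) → Generated a
  Generated-zero {a = a} vanish =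
    scal 0# , λ t → ≈-trans (coeff-scaleT 0# (oneT R m) t) (≈-trans (zeroˡ _) (≈-sym (vanish t)))

  eProductExpr : (k : Word m → ℕ) (U : List (Word m)) →
    ListAll (λ υ → 1 ≤ length υ × 1 ≤ k υ × k υ ≤ n) U → GenExpr R m n
  eProductExpr k [] [] = scal 1#
  eProductExpr k (υ ∷ U) ((1≤len , 1≤k , k≤n) ∷ bounds) = times (gen (k υ) 1≤k k≤n υ 1≤len) (eProductExpr k U bounds)

  eval-eProductExpr : (k : Word m → ℕ) (U : List (Word m)) →
    ∀ bounds → eval R m (eProductExpr {n} k U bounds) ≡ eProduct k U
  eval-eProductExpr k [] [] = refl
  eval-eProductExpr {n} k (υ ∷ U) (_ ∷ bounds) =
    cong (mulT R m (e R m n (k υ) (mono R m υ))) (eval-eProductExpr k U bounds)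

  Generated-orbitProduct : (t : Tup m n) → Generated (orbitProduct t)
  Generated-orbitProduct {n} t =
    eProductExpr k U bounds , λ s → reflexive (cong (λ a → coeff R m a s) (eval-eProductExpr k U bounds))
    where
    k : Word m → ℕ
    k υ = count υ t
    U : List (Word m)
    U = distinctEntries t
    bounds : ListAll (λ υ → 1 ≤ length υ × 1 ≤ k υ × k υ ≤ n) U
    bounds = ListAll.tabulate λ υ∈U → let υ≢[] , 1≤k = ∈-distinctEntries t υ∈U in 1≤length υ≢[] , 1≤k , count-≤ _ t
      where
      1≤length : ∀ {υ : Word m} → υ ≢ [] → 1 ≤ length υ
      1≤length {[]} υ≢[] = ⊥-elim (υ≢[] refl)
      1≤length {_ ∷ _} _ = s≤s z≤n

  module _ (a : Tensor R m n) (a-symmetric : IsSymmetric R m a) (t : Tup m n) where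
    private
      c : K
      c = coeff R m a t
      P : Tensor R m n
      P = orbitProduct t

    cleared : Tensor R m n
    cleared = a ++ scaleT R m (- c) P

    coeff-cleared : ∀ s → coeff R m cleared s ≈ coeff R m a s + (- c) * coeff R m P s
    coeff-cleared s = ≈-trans (coeff-++ a _ s) (+-congˡ (coeff-scaleT (- c) P s))

    cleared-symmetric : IsSymmetric R m cleared
    cleared-symmetric σ s = begin
      coeff R m cleared (permuteTup σ s)
        ≈⟨ coeff-cleared (permuteTup σ s) ⟩
      coeff R m a (permuteTup σ s) + (- c) * coeff R m P (permuteTup σ s)
        ≈⟨ +-cong (a-symmetric σ s) (*-congˡ (orbitProduct-symmetric t σ s)) ⟩
      coeff R m a s + (- c) * coeff R m P s
        ≈⟨ coeff-cleared s ⟨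
      coeff R m cleared s
        ∎

    cleared-top : ∀ s → degree t ≤ degree s → coeff R m cleared s ≈ 0# ⊎ (s ≢ t × coeff R m cleared s ≈ coeff R m a s)
    cleared-top s deg≤ with orbitProduct-top t s deg≤
    ... | inj₁ (s∼t , P≈1) = inj₁ (begin
      coeff R m cleared s                   ≈⟨ coeff-cleared s ⟩
      coeff R m a s + (- c) * coeff R m P s ≈⟨ +-cong a-orbit (*-congˡ P≈1) ⟩
      c + (- c) * 1#                        ≈⟨ +-congˡ (*-identityʳ (- c)) ⟩
      c - c                                 ≈⟨ -‿inverseʳ c ⟩
      0#                                    ∎)
      where
      a-orbit : coeff R m a s ≈ c
      a-orbit = ≈-trans (reflexive (cong (coeff R m a) (_∼_.≡-permuteTup s∼t))) (a-symmetric (_∼_.perm s∼t) t)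
    ... | inj₂ (s≢t , P≈0) = inj₂ (s≢t , (begin
      coeff R m cleared s                   ≈⟨ coeff-cleared s ⟩
      coeff R m a s + (- c) * coeff R m P s ≈⟨ +-congˡ (≈-trans (*-congˡ P≈0) (zeroʳ (- c))) ⟩
      coeff R m a s + 0#                    ≈⟨ +-identityʳ _ ⟩
      coeff R m a s                         ∎))

    Generated-cleared : Generated cleared → Generated a
    Generated-cleared g = Generated-resp {a = cleared ++ scaleT R m c P} {a} restored
      (Generated-++ {a = cleared} g (Generated-scale c {P} (Generated-orbitProduct t)))
      where
      restored : _≈T_ R m (cleared ++ scaleT R m c P) a
      restored s = begin
        coeff R m (cleared ++ scaleT R m c P) s
          ≈⟨ ≈-trans (coeff-++ cleared _ s) (+-cong (coeff-cleared s) (coeff-scaleT c P s)) ⟩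
        coeff R m a s + (- c) * coeff R m P s + c * coeff R m P s
          ≈⟨ x-cy+cy≈x _ c _ ⟩
        coeff R m a s
          ∎

  coeff-∉-keys : (a : Tensor R m n) (s : Tup m n) → s ∉ map proj₂ a → coeff R m a s ≈ 0#
  coeff-∉-keys [] s _ = ≈-refl
  coeff-∉-keys ((r , u) ∷ a) s s∉ with tup-≟ u s
  ... | yes refl = ⊥-elim (s∉ (here refl))
  ... | no _ = coeff-∉-keys a s (s∉ ∘ there)

  VanishesFrom : ℕ → Tensor R m n → Set ℓ₂
  VanishesFrom p a = ∀ s → p ≤ degree s → coeff R m a s ≈ 0#

  -- L lists the keys of the tensor we started from: clearing an orbit of degree p leaves nonzero
  -- coefficients at new keys only in degree < p.
  Generated-degree : ∀ p → (∀ b → IsSymmetric R m b → VanishesFrom p b → Generated b) →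
    ∀ (L : List (Tup m n)) a → IsSymmetric R m a → VanishesFrom (suc p) a →
    (∀ s → degree s ≡ p → s ∉ L → coeff R m a s ≈ 0#) → Generated a
  Generated-degree p lower [] a a-symmetric above rest = lower a a-symmetric vanish
    where
    vanish : VanishesFrom p a
    vanish s p≤deg with m≤n⇒m<n∨m≡n p≤deg
    ... | inj₁ p<deg = above s p<deg
    ... | inj₂ p≡deg = rest s (Eq.sym p≡deg) λ ()
  Generated-degree p lower (t ∷ L) a a-symmetric above rest with degree t ≟ p
  ... | no deg≢p = Generated-degree p lower L a a-symmetric above
        λ s deg s∉L → rest s deg λ { (here refl) → deg≢p deg ; (there s∈L) → s∉L s∈L }
  ... | yes refl = Generated-cleared a a-symmetric t
        (Generated-degree p lower L (cleared a a-symmetric t) (cleared-symmetric a a-symmetric t) above′ rest′)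
    where
    above′ : VanishesFrom (suc p) (cleared a a-symmetric t)
    above′ s p<deg with cleared-top a a-symmetric t s (<⇒≤ p<deg)
    ... | inj₁ vanishes = vanishes
    ... | inj₂ (_ , unchanged) = ≈-trans unchanged (above s p<deg)
    rest′ : ∀ s → degree s ≡ p → s ∉ L → coeff R m (cleared a a-symmetric t) s ≈ 0#
    rest′ s deg s∉L with cleared-top a a-symmetric t s (≤-reflexive (Eq.sym deg))
    ... | inj₁ vanishes = vanishes
    ... | inj₂ (s≢t , unchanged) = ≈-trans unchanged (rest s deg λ { (here s≡t) → s≢t s≡t ; (there s∈L) → s∉L s∈L })

  Generated-symmetric : ∀ p (a : Tensor R m n) → IsSymmetric R m a → VanishesFrom (suc p) a → Generated a
  Generated-symmetric p a a-symmetric above =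
    Generated-degree p (below p) (map proj₂ a) a a-symmetric above (λ s _ → coeff-∉-keys a s)
    where
    below : ∀ q b → IsSymmetric R m b → VanishesFrom q b → Generated b
    below zero b _ vanish = Generated-zero {a = b} (λ s → vanish s z≤n)
    below (suc q) = Generated-symmetric q

open Tuples using (degree-≤)
open SymmetricTensors using (Generated-symmetric)

mainTheorem16 : ∀ {c ℓ} (R : CommutativeRing c ℓ) (m n : ℕ) → 1 ≤ n →
    (a : Tensor R m n) → IsSymmetric R m a →
    Σ (GenExpr R m n) (λ x → _≈T_ R m (eval R m x) a)
mainTheorem16 R m n _ a a-symmetric =
  Generated-symmetric R m n a a-symmetric (λ s n<degree → ⊥-elim (<⇒≱ n<degree (degree-≤ s)))
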